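{- Let $r\ge1$ and $k\ge2$ be integers and $n=kr$. Consider the following randomized procedure: choose permutations $\sigma=\sigma_1\cdots\sigma_n$ and $\tau=\tau_1\cdots\tau_n$ of $\{1,\dots,n\}$ independently and uniformly at random from $S_n$, and define $f:\{1,\dots,n\}\to\{1,\dots,n\}$ by $f(\tau_{ik+j})=\sigma_{i+1}$ for $i=0,\dots,r-1$ and $j=1,\dots,k$. Then $f$ is a uniformly random $\{0,k\}$-mapping on $n$ nodes, i.e., every $\{0,k\}$-mapping on $\{1,\dots,n\}$ is output with the same probability.
   Context: A $\{0,k\}$-mapping on $n$ nodes is a function $f:\{1,\dots,n\}\to\{1,\dots,n\}$ with $|f^{ -1}(y)|\in\{0,k\}$ for every $y$. -}

module Defs where

open import Data.Nat using (ℕ; zero; suc; _*_; _<_)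
open import Data.Nat.Properties using (*-zeroʳ; <-≤-trans; m≤m*n)
open import Data.Fin using (Fin; toℕ; fromℕ<; quotient; _≟_)
open import Data.Fin.Properties using (toℕ<n)
open import Data.Vec using (Vec; []; _∷_; lookup; toList)
open import Data.List using (List; [_]; concatMap; map; allFin; length; filter; cartesianProduct)
open import Data.List.Relation.Unary.Unique.Propositional using (Unique)
import Data.List.Relation.Unary.Unique.DecPropositional as UDec
open import Data.Product using (_×_; _,_)
open import Relation.Binary.PropositionalEquality using (_≡_; subst)
open import Relation.Nullary using (Dec)
open import Data.Fin.Properties using (all?)

-- A permutation σ = σ₁⋯σₙ of {1,…,n} (here Fin n), written as a word of
-- length n with pairwise distinct letters.
IsPerm : ∀ {n} → Vec (Fin n) n → Set
IsPerm v = Unique (toList v)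

isPerm? : ∀ {n} (v : Vec (Fin n) n) → Dec (IsPerm v)
isPerm? {n} v = UDec.unique? (_≟_ {n}) (toList v)

allWords : (n m : ℕ) → List (Vec (Fin n) m)
allWords n zero    = [ [] ]
allWords n (suc m) = concatMap (λ x → map (x ∷_) (allWords n m)) (allFin n)

allPerms : (n : ℕ) → List (Vec (Fin n) n)
allPerms n = filter isPerm? (allWords n n)

preimageSize : ∀ {n} → (Fin n → Fin n) → Fin n → ℕ
preimageSize {n} g y = length (filter (λ x → g x ≟ y) (allFin n))

Is0kMapping : (k : ℕ) → ∀ {n} → (Fin n → Fin n) → Set
Is0kMapping k g = ∀ y → (preimageSize g y ≡ 0) ⊎' (preimageSize g y ≡ k)
  where
  open import Data.Sum using () renaming (_⊎_ to _⊎'_)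

-- For a position p = ik + (j-1) (0-based, 0 ≤ j-1 < k) in {0,…,rk-1},
-- the 0-based position i of σ_{i+1}, viewed in Fin (r * k).
private
  quot<n : ∀ r k (p : Fin (r * k)) → toℕ (quotient {r} k p) < r * k
  quot<n r zero p = ⊥-elim' (subst Fin (*-zeroʳ r) p)
    where
    ⊥-elim' : Fin 0 → _
    ⊥-elim' ()
  quot<n r (suc k) p = <-≤-trans (toℕ<n (quotient {r} (suc k) p)) (m≤m*n r (suc k))

blockPos : ∀ r k → Fin (r * k) → Fin (r * k)
blockPos r k p = fromℕ< (quot<n r k p)

-- The procedure outputs g from (σ, τ): g(τ_{ik+j}) = σ_{i+1} for all i, j
-- (0-based: g (τ[p]) = σ[⌊p/k⌋] for every position p).
Produces : ∀ r k → (σ τ : Vec (Fin (r * k)) (r * k)) → (Fin (r * k) → Fin (r * k)) → Set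
Produces r k σ τ g = ∀ p → g (lookup τ p) ≡ lookup σ (blockPos r k p)

produces? : ∀ r k σ τ g → Dec (Produces r k σ τ g)
produces? r k σ τ g = all? (λ p → g (lookup τ p) ≟ lookup σ (blockPos r k p))

fibreSize : ∀ r k → (Fin (r * k) → Fin (r * k)) → ℕ
fibreSize r k g =
  length (filter (λ st → produces? r k (Data.Product.proj₁ st) (Data.Product.proj₂ st) g)
                 (cartesianProduct (allPerms (r * k)) (allPerms (r * k))))
  where import Data.Product

module Submission where

-- Call g a relabelling of f when g ∘ β = α ∘ f for bijections α, β
-- of Fin n.  With n = r * k and c = blockPos r k (position p ↦ block ⌊p/k⌋),
-- the procedure run on (σ, τ) produces f exactly when (lookup σ, lookup τ)
-- witnesses that f is a relabelling of c.  The proof then rests on three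
-- facts about relabellings:
--   * they preserve the {0,k}-property, and c itself is a {0,k}-mapping,
--     so every output of the procedure is a {0,k}-mapping (part 1);
--   * every {0,k}-mapping f is a relabelling of c: list the r values with
--     full fibres first (α), and enumerate their fibres block by block (β);
--   * relabelling by (α, β) maps the fibre {(σ, τ) ↦ f} bijectively onto
--     {(σ, τ) ↦ g} via (σ, τ) ↦ (α ∘ σ, β ∘ τ), so fibre sizes agree.
-- Hence any two {0,k}-mappings are relabellings of each other and have
-- fibres of equal size (part 2).  Counting is done on duplicate-free lists:
-- two such lists in bijection have equal length.

open import Defs
open import Data.Nat using (ℕ; zero; suc; _+_; _*_; _<_; _≤_; NonZero)
import Data.Nat as ℕ
import Data.Nat.Properties as ℕ
open import Data.Fin
  using (Fin; zero; suc; toℕ; fromℕ<; quotient; remainder; combine; cast; punchOut; _≟_)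
open import Data.Fin.Properties
  using (toℕ-injective; toℕ-fromℕ<; toℕ<n; toℕ-cast; any?; punchOut-injective; injective⇒≤;
         combine-injective; remQuot-combine; combine-remQuot)
open import Data.List
  using (List; []; _∷_; length; map; lookup; concat; allFin; filter; _++_; cartesianProduct)
open import Data.List.Properties using (length-map; length-++; length-tabulate; filter-none; filter-accept; filter-reject)
open import Data.List.Membership.Propositional using (_∈_)
open import Data.List.Membership.Propositional.Properties
  using (∈-map⁺; ∈-map⁻; ∈-filter⁺; ∈-filter⁻; ∈-allFin; ∈-lookup; ∈-concat⁺′; ∈-++⁺ˡ; ∈-++⁺ʳ;
         ∈-cartesianProduct⁺; ∈-cartesianProduct⁻)
open import Data.List.Membership.Propositional.Properties.WithK using (unique∧set⇒bag)
open import Data.List.Relation.Binary.BagAndSetEquality using (∼bag⇒↭)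
open import Data.List.Relation.Binary.Permutation.Propositional.Properties using (↭-length)
open import Data.List.Relation.Unary.Unique.Propositional using (Unique)
import Data.List.Relation.Unary.Unique.Propositional.Properties as Unique
import Data.List.Relation.Unary.All as All
import Data.List.Relation.Unary.All.Properties as All
import Data.List.Relation.Unary.AllPairs as AllPairs
import Data.List.Relation.Unary.AllPairs.Properties as AllPairs
open import Data.Vec using (Vec; []; _∷_; toList)
import Data.Vec as Vec
import Data.Vec.Properties as Vec
open import Data.Vec.Membership.Propositional.Properties using (∈-toList⁺)
import Data.Vec.Membership.Propositional.Properties as Vec∈
open import Data.Product using (Σ; ∃; _×_; _,_; proj₁; proj₂)
open import Data.Sum using (inj₁; inj₂)
open import Data.List.Relation.Unary.Any using (here)
open import Data.Empty using (⊥-elim)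
open import Function using (_∘_)
open import Function.Bundles using (_↔_; Inverse; Injection; mk↔ₛ′; mk⇔)
open import Function.Definitions using (Injective)
open import Function.Properties.Inverse using (↔-sym; ↔-trans; ↔⇒↣)
open import Relation.Nullary using (Dec; yes; no; ¬_; ¬?)
open import Relation.Binary.PropositionalEquality
open ≡-Reasoning

open Inverse using (to; from; strictlyInverseˡ; strictlyInverseʳ)

length-≡-by-bijection :
  ∀ {a b} {A : Set a} {B : Set b} {xs : List A} {ys : List B} (F : A → B) →
  Unique xs → Unique ys → Injective _≡_ _≡_ F →
  (∀ {x} → x ∈ xs → F x ∈ ys) → (∀ {y} → y ∈ ys → ∃ λ x → x ∈ xs × y ≡ F x) →
  length xs ≡ length ys
length-≡-by-bijection {xs = xs} {ys} F xs! ys! F-inj into onto = begin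
  length xs         ≡⟨ length-map F xs ⟨
  length (map F xs) ≡⟨ ↭-length (∼bag⇒↭ (unique∧set⇒bag (Unique.map⁺ F-inj xs!) ys! (mk⇔ ⊆ ⊇))) ⟩
  length ys         ∎
  where
  ⊆ : ∀ {y} → y ∈ map F xs → y ∈ ys
  ⊆ y∈ with x , x∈ , refl ← ∈-map⁻ F y∈ = into x∈
  ⊇ : ∀ {y} → y ∈ ys → y ∈ map F xs
  ⊇ y∈ with x , x∈ , refl ← onto y∈ = ∈-map⁺ F x∈

length-allFin : ∀ n → length (allFin n) ≡ n
length-allFin n = length-tabulate (λ x → x)

complete-length : ∀ {n} {xs : List (Fin n)} → Unique xs → (∀ x → x ∈ xs) → length xs ≡ n
complete-length {n} {xs} xs! complete = begin
  length xs         ≡⟨ length-≡-by-bijection (λ x → x) xs! (Unique.allFin⁺ n) (λ e → e)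
                         (λ {x} _ → ∈-allFin x) (λ {x} _ → x , complete x , refl) ⟩
  length (allFin n) ≡⟨ length-allFin n ⟩
  n                 ∎

lookup-injective : ∀ {a} {A : Set a} (xs : List A) → Unique xs →
  ∀ i j → lookup xs i ≡ lookup xs j → i ≡ j
lookup-injective (x ∷ xs) _                  zero    zero    _ = refl
lookup-injective (x ∷ xs) (x∉ AllPairs.∷ _)  zero    (suc j) e = ⊥-elim (All.lookup x∉ (∈-lookup j) e)
lookup-injective (x ∷ xs) (x∉ AllPairs.∷ _)  (suc i) zero    e = ⊥-elim (All.lookup x∉ (∈-lookup i) (sym e))
lookup-injective (x ∷ xs) (_ AllPairs.∷ xs!) (suc i) (suc j) e = cong suc (lookup-injective xs xs! i j e)

nth : ∀ {a} {A : Set a} {m} (xs : List A) → length xs ≡ m → Fin m → A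
nth xs len i = lookup xs (cast (sym len) i)

nth-∈ : ∀ {a} {A : Set a} {m} (xs : List A) (len : length xs ≡ m) i → nth xs len i ∈ xs
nth-∈ xs len i = ∈-lookup (cast (sym len) i)

nth-injective : ∀ {a} {A : Set a} {m} (xs : List A) (len : length xs ≡ m) → Unique xs →
  Injective _≡_ _≡_ (nth xs len)
nth-injective xs len xs! {i} {j} e = toℕ-injective (begin
  toℕ i                    ≡⟨ toℕ-cast (sym len) i ⟨
  toℕ (cast (sym len) i)   ≡⟨ cong toℕ (lookup-injective xs xs! _ _ e) ⟩
  toℕ (cast (sym len) j)   ≡⟨ toℕ-cast (sym len) j ⟩
  toℕ j                    ∎)

nth-++ˡ : ∀ {a} {A : Set a} {m l} (xs ys : List A) (len : length (xs ++ ys) ≡ m)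
  (lenˡ : length xs ≡ l) i j → toℕ i ≡ toℕ j → nth (xs ++ ys) len i ≡ nth xs lenˡ j
nth-++ˡ xs ys len lenˡ i j e = lookup-++ˡ xs (cast (sym len) i) (cast (sym lenˡ) j)
  (trans (toℕ-cast (sym len) i) (trans e (sym (toℕ-cast (sym lenˡ) j))))
  where
  lookup-++ˡ : ∀ xs (i : Fin (length (xs ++ ys))) (j : Fin (length xs)) →
    toℕ i ≡ toℕ j → lookup (xs ++ ys) i ≡ lookup xs j
  lookup-++ˡ (x ∷ xs) zero    zero    _ = refl
  lookup-++ˡ (x ∷ xs) (suc i) (suc j) e = lookup-++ˡ xs i j (ℕ.suc-injective e)

-- Pigeonhole: an injective endomap of Fin n is onto.
injective⇒surjective : ∀ {n} (h : Fin n → Fin n) → Injective _≡_ _≡_ h → ∀ y → ∃ λ x → h x ≡ y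
injective⇒surjective {suc m} h h-inj y with any? (λ x → h x ≟ y)
... | yes hit = hit
... | no miss = ⊥-elim (ℕ.<-irrefl refl (injective⇒≤ {f = avoid} avoid-inj))
  where
  avoid : Fin (suc m) → Fin m
  avoid x = punchOut {i = y} (λ e → miss (x , sym e))
  avoid-inj : Injective _≡_ _≡_ avoid
  avoid-inj {a} {b} e = h-inj (punchOut-injective {i = y} (λ e → miss (a , sym e)) (λ e → miss (b , sym e)) e)

injective⇒↔ : ∀ {n} (h : Fin n → Fin n) → Injective _≡_ _≡_ h → Fin n ↔ Fin n
injective⇒↔ h h-inj = mk↔ₛ′ h (λ y → proj₁ (onto y)) (λ y → proj₂ (onto y))
  (λ x → h-inj (proj₂ (onto (h x))))
  where
  onto : ∀ y → ∃ λ x → h x ≡ y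
  onto = injective⇒surjective h h-inj

to-injective : ∀ {n} (α : Fin n ↔ Fin n) → Injective _≡_ _≡_ (to α)
to-injective α = Injection.injective (↔⇒↣ α)

word↔ : ∀ {n} (v : Vec (Fin n) n) → IsPerm v → Fin n ↔ Fin n
word↔ {n} v v-perm = injective⇒↔ (Vec.lookup v) (lookup-inj v v-perm)
  where
  lookup-inj : ∀ {m} (v : Vec (Fin n) m) → Unique (toList v) → Injective _≡_ _≡_ (Vec.lookup v)
  lookup-inj (x ∷ v) _ {zero} {zero} _ = refl
  lookup-inj (x ∷ v) (x∉ AllPairs.∷ _) {zero} {suc j} e = ⊥-elim (All.lookup x∉ (∈-toList⁺ (Vec∈.∈-lookup j v)) e)
  lookup-inj (x ∷ v) (x∉ AllPairs.∷ _) {suc i} {zero} e = ⊥-elim (All.lookup x∉ (∈-toList⁺ (Vec∈.∈-lookup i v)) (sym e))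
  lookup-inj (x ∷ v) (_ AllPairs.∷ v!) {suc i} {suc j} e = cong suc (lookup-inj v v! e)

map-isPerm : ∀ {n} (α : Fin n ↔ Fin n) {v : Vec (Fin n) n} → IsPerm v → IsPerm (Vec.map (to α) v)
map-isPerm α {v} v-perm = subst Unique (sym (Vec.toList-map (to α) v)) (Unique.map⁺ (to-injective α) v-perm)

map-from-to : ∀ {n m} (α : Fin n ↔ Fin n) (v : Vec (Fin n) m) → Vec.map (to α) (Vec.map (from α) v) ≡ v
map-from-to α v = begin
  Vec.map (to α) (Vec.map (from α) v) ≡⟨ Vec.map-∘ (to α) (from α) v ⟨
  Vec.map (to α ∘ from α) v           ≡⟨ Vec.map-cong (strictlyInverseˡ α) v ⟩
  Vec.map (λ x → x) v                 ≡⟨ Vec.map-id v ⟩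
  v                                   ∎

map-to-injective : ∀ {n m} (α : Fin n ↔ Fin n) → Injective _≡_ _≡_ (Vec.map {n = m} (to α))
map-to-injective α {u} {v} e = begin
  u                                   ≡⟨ map-from-to (↔-sym α) u ⟨
  Vec.map (from α) (Vec.map (to α) u) ≡⟨ cong (Vec.map (from α)) e ⟩
  Vec.map (from α) (Vec.map (to α) v) ≡⟨ map-from-to (↔-sym α) v ⟩
  v                                   ∎

preimage : ∀ {n m} (g : Fin n → Fin m) → Fin m → List (Fin n)
preimage {n} g y = filter (λ x → g x ≟ y) (allFin n)

preimage! : ∀ {n m} (g : Fin n → Fin m) y → Unique (preimage g y)
preimage! {n} g y = Unique.filter⁺ _ (Unique.allFin⁺ n)

∈-preimage⁺ : ∀ {n m} (g : Fin n → Fin m) {x y} → g x ≡ y → x ∈ preimage g y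
∈-preimage⁺ g {x} {y} e = ∈-filter⁺ (λ x → g x ≟ y) (∈-allFin x) e

∈-preimage⁻ : ∀ {n m} (g : Fin n → Fin m) {x y} → x ∈ preimage g y → g x ≡ y
∈-preimage⁻ {n} g {y = y} x∈ = proj₂ (∈-filter⁻ (λ x → g x ≟ y) {xs = allFin n} x∈)

length-preimages : ∀ {n m} (g : Fin n → Fin m) → length (concat (map (preimage g) (allFin m))) ≡ n
length-preimages {n} {m} g = complete-length preimages! complete
  where
  disjoint : AllPairs.AllPairs (λ y y′ → ∀ {x} → ¬ (x ∈ preimage g y × x ∈ preimage g y′)) (allFin m)
  disjoint = AllPairs.map (λ y≢y′ {x} (x∈ , x∈′) → y≢y′ (trans (sym (∈-preimage⁻ g x∈)) (∈-preimage⁻ g x∈′)))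
                          (Unique.allFin⁺ m)
  preimages! : Unique (concat (map (preimage g) (allFin m)))
  preimages! = Unique.concat⁺ (All.map⁺ (All.tabulate⁺ (preimage! g))) (AllPairs.map⁺ disjoint)
  complete : ∀ x → x ∈ concat (map (preimage g) (allFin m))
  complete x = ∈-concat⁺′ (∈-preimage⁺ g refl) (∈-map⁺ (preimage g) (∈-allFin (g x)))

-- Relabellings

record Relabelling {n} (f g : Fin n → Fin n) : Set where
  field
    cod dom  : Fin n ↔ Fin n
    commutes : ∀ x → g (to dom x) ≡ to cod (f x)

open Relabelling

relabel-sym : ∀ {n} {f g : Fin n → Fin n} → Relabelling f g → Relabelling g f
relabel-sym {f = f} {g} R = record
  { cod = ↔-sym (cod R) ; dom = ↔-sym (dom R) ; commutes = commutes⁻¹ }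
  where
  commutes⁻¹ : ∀ y → f (from (dom R) y) ≡ from (cod R) (g y)
  commutes⁻¹ y = sym (begin
    from (cod R) (g y)                               ≡⟨ cong (from (cod R) ∘ g) (strictlyInverseˡ (dom R) y) ⟨
    from (cod R) (g (to (dom R) (from (dom R) y)))   ≡⟨ cong (from (cod R)) (commutes R _) ⟩
    from (cod R) (to (cod R) (f (from (dom R) y)))   ≡⟨ strictlyInverseʳ (cod R) _ ⟩
    f (from (dom R) y)                               ∎)

relabel-trans : ∀ {n} {f g h : Fin n → Fin n} → Relabelling f g → Relabelling g h → Relabelling f h
relabel-trans {f = f} {g} {h} R S = record
  { cod = ↔-trans (cod R) (cod S) ; dom = ↔-trans (dom R) (dom S)
  ; commutes = λ x → trans (commutes S _) (cong (to (cod S)) (commutes R x)) }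

-- Fibres of a relabelling are the images of the fibres of the original map.
preimageSize-relabel : ∀ {n} {f g : Fin n → Fin n} (R : Relabelling f g) y →
  preimageSize g (to (cod R) y) ≡ preimageSize f y
preimageSize-relabel {f = f} {g} R y = sym
  (length-≡-by-bijection (to (dom R)) (preimage! f y) (preimage! g _) (to-injective (dom R)) into onto)
  where
  into : ∀ {x} → x ∈ preimage f y → to (dom R) x ∈ preimage g (to (cod R) y)
  into {x} x∈ = ∈-preimage⁺ g (trans (commutes R x) (cong (to (cod R)) (∈-preimage⁻ f x∈)))
  onto : ∀ {x} → x ∈ preimage g (to (cod R) y) → ∃ λ x′ → x′ ∈ preimage f y × x ≡ to (dom R) x′
  onto {x} x∈ = from (dom R) x , ∈-preimage⁺ f f-x′≡y , sym (strictlyInverseˡ (dom R) x)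
    where
    f-x′≡y : f (from (dom R) x) ≡ y
    f-x′≡y = to-injective (cod R) (begin
      to (cod R) (f (from (dom R) x))  ≡⟨ commutes R _ ⟨
      g (to (dom R) (from (dom R) x))  ≡⟨ cong g (strictlyInverseˡ (dom R) x) ⟩
      g x                              ≡⟨ ∈-preimage⁻ g x∈ ⟩
      to (cod R) y                     ∎)

relabel-is0k : ∀ {n k} {f g : Fin n → Fin n} → Relabelling f g → Is0kMapping k f → Is0kMapping k g
relabel-is0k {g = g} R f-0k y
  rewrite sym (strictlyInverseˡ (cod R) y) | preimageSize-relabel R (from (cod R) y)
  = f-0k (from (cod R) y)

toℕ-blockPos : ∀ r k p → toℕ (blockPos r k p) ≡ toℕ (quotient {r} k p)
toℕ-blockPos r k p = toℕ-fromℕ< _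

-- Block i (for i < r) is the preimage of i: it consists of the k positions combine i j.
blockPos-is0k : ∀ r k → Is0kMapping k (blockPos r k)
blockPos-is0k r k y with toℕ y ℕ.<? r
... | no y≮r = inj₁ (cong length (filter-none (λ x → blockPos r k x ≟ y) (All.tabulate⁺ outside)))
  where
  outside : ∀ x → blockPos r k x ≢ y
  outside x e = y≮r (subst (_< r) (trans (sym (toℕ-blockPos r k x)) (cong toℕ e)) (toℕ<n (quotient {r} k x)))
... | yes y<r = inj₂ (sym (trans (sym (length-allFin k))
    (length-≡-by-bijection (combine i) (Unique.allFin⁺ k) (preimage! _ y)
       (λ {a} {b} e → proj₂ (combine-injective i a i b e)) into onto)))
  where
  i : Fin r
  i = fromℕ< y<r
  quotient≡i : ∀ x → blockPos r k x ≡ y → quotient {r} k x ≡ i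
  quotient≡i x e = toℕ-injective (begin
    toℕ (quotient {r} k x) ≡⟨ toℕ-blockPos r k x ⟨
    toℕ (blockPos r k x)   ≡⟨ cong toℕ e ⟩
    toℕ y                  ≡⟨ toℕ-fromℕ< y<r ⟨
    toℕ i                  ∎)
  into : ∀ {j} → j ∈ allFin k → combine i j ∈ preimage (blockPos r k) y
  into {j} _ = ∈-preimage⁺ (blockPos r k) (toℕ-injective (begin
    toℕ (blockPos r k (combine i j))   ≡⟨ toℕ-blockPos r k _ ⟩
    toℕ (quotient {r} k (combine i j)) ≡⟨ cong (toℕ ∘ proj₁) (remQuot-combine i j) ⟩
    toℕ i                              ≡⟨ toℕ-fromℕ< y<r ⟩
    toℕ y                              ∎))
  onto : ∀ {x} → x ∈ preimage (blockPos r k) y → ∃ λ j → j ∈ allFin k × x ≡ combine i j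
  onto {x} x∈ = remainder {r} k x , ∈-allFin _ , (begin
    x                                              ≡⟨ combine-remQuot {r} k x ⟨
    combine (quotient {r} k x) (remainder {r} k x) ≡⟨ cong (λ q → combine q _) (quotient≡i x (∈-preimage⁻ _ x∈)) ⟩
    combine i (remainder {r} k x)                  ∎)

-- Every {0,k}-mapping is a relabelling of the block map

module CanonicalForm (r k : ℕ) .{{_ : NonZero k}} (f : Fin (r * k) → Fin (r * k))
                     (f-0k : Is0kMapping k f) where

  n : ℕ
  n = r * k

  IsFull? : (y : Fin n) → Dec (preimageSize f y ≡ k)
  IsFull? y = preimageSize f y ℕ.≟ k

  Full Rest : List (Fin n)
  Full = filter IsFull? (allFin n)
  Rest = filter (¬? ∘ IsFull?) (allFin n)

  length-preimages-of : ∀ ys → length (concat (map (preimage f) ys)) ≡ k * length (filter IsFull? ys)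
  length-preimages-of [] = sym (ℕ.*-zeroʳ k)
  length-preimages-of (y ∷ ys) with IsFull? y | f-0k y
  ... | yes full | _ = begin
    length (preimage f y ++ concat (map (preimage f) ys))  ≡⟨ length-++ (preimage f y) ⟩
    preimageSize f y + length (concat (map (preimage f) ys)) ≡⟨ cong₂ _+_ full (length-preimages-of ys) ⟩
    k + k * length (filter IsFull? ys)                      ≡⟨ ℕ.*-suc k _ ⟨
    k * suc (length (filter IsFull? ys))                    ≡⟨ cong (λ l → k * length l) (filter-accept IsFull? full) ⟨
    k * length (filter IsFull? (y ∷ ys))                    ∎
  ... | no ¬full | inj₂ full = ⊥-elim (¬full full)
  ... | no empty | inj₁ none = begin
    length (preimage f y ++ concat (map (preimage f) ys))  ≡⟨ length-++ (preimage f y) ⟩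
    preimageSize f y + length (concat (map (preimage f) ys)) ≡⟨ cong₂ _+_ none (length-preimages-of ys) ⟩
    k * length (filter IsFull? ys)                          ≡⟨ cong (λ l → k * length l) (filter-reject IsFull? empty) ⟨
    k * length (filter IsFull? (y ∷ ys))                    ∎

  -- Counting the domain as k · |Full| = r · k gives exactly r full values.
  length-Full : length Full ≡ r
  length-Full = ℕ.*-cancelˡ-≡ _ _ k (begin
    k * length Full                              ≡⟨ length-preimages-of (allFin n) ⟨
    length (concat (map (preimage f) (allFin n))) ≡⟨ length-preimages f ⟩
    r * k                                        ≡⟨ ℕ.*-comm r k ⟩
    k * r                                        ∎)

  -- All nodes, full values first; position i < r holds the i-th full value.
  Labels : List (Fin n)
  Labels = Full ++ Rest

  Labels! : Unique Labels
  Labels! = Unique.++⁺ (Unique.filter⁺ _ (Unique.allFin⁺ n)) (Unique.filter⁺ _ (Unique.allFin⁺ n))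
    λ (y∈Full , y∈Rest) → proj₂ (∈-filter⁻ (¬? ∘ IsFull?) {xs = allFin n} y∈Rest)
                                (proj₂ (∈-filter⁻ IsFull? {xs = allFin n} y∈Full))

  length-Labels : length Labels ≡ n
  length-Labels = complete-length Labels! complete
    where
    complete : ∀ y → y ∈ Labels
    complete y with IsFull? y
    ... | yes full = ∈-++⁺ˡ (∈-filter⁺ IsFull? (∈-allFin y) full)
    ... | no empty = ∈-++⁺ʳ Full (∈-filter⁺ (¬? ∘ IsFull?) (∈-allFin y) empty)

  value : Fin r → Fin n
  value = nth Full length-Full

  value-full : ∀ q → preimageSize f (value q) ≡ k
  value-full q = proj₂ (∈-filter⁻ IsFull? {xs = allFin n} (nth-∈ Full length-Full q))

  point : Fin r → Fin k → Fin n
  point q = nth (preimage f (value q)) (value-full q)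

  f-point : ∀ q j → f (point q j) ≡ value q
  f-point q j = ∈-preimage⁻ f (nth-∈ (preimage f (value q)) (value-full q) j)

  point-injective : ∀ q j q′ j′ → point q j ≡ point q′ j′ → q ≡ q′ × j ≡ j′
  point-injective q j q′ j′ e
    with refl ← nth-injective Full length-Full (Unique.filter⁺ _ (Unique.allFin⁺ n))
                  (trans (sym (f-point q j)) (trans (cong f e) (f-point q′ j′)))
    = refl , nth-injective (preimage f (value q)) (value-full q) (preimage! f _) e

  -- α : block i ↦ i-th entry of Labels;  β : position p ↦ point ⌊p/k⌋ (p mod k).
  codomain-labels : Fin n ↔ Fin n
  codomain-labels = injective⇒↔ (nth Labels length-Labels) (nth-injective Labels length-Labels Labels!)

  domain-labels : Fin n ↔ Fin n
  domain-labels = injective⇒↔ (λ p → point (quotient {r} k p) (remainder {r} k p)) injective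
    where
    injective : Injective _≡_ _≡_ (λ p → point (quotient {r} k p) (remainder {r} k p))
    injective {a} {b} e with point-injective _ _ _ _ e
    ... | q≡ , j≡ = trans (sym (combine-remQuot {r} k a)) (trans (cong₂ combine q≡ j≡) (combine-remQuot {r} k b))

  -- f (β p) is the ⌊p/k⌋-th full value, which is α (blockPos p).
  relabelling : Relabelling (blockPos r k) f
  relabelling = record { cod = codomain-labels ; dom = domain-labels ; commutes = commutes′ }
    where
    commutes′ : ∀ p → f (point (quotient {r} k p) (remainder {r} k p)) ≡ nth Labels length-Labels (blockPos r k p)
    commutes′ p = trans (f-point _ _) (sym (nth-++ˡ Full Rest length-Labels length-Full _ _ (toℕ-blockPos r k p)))

-- The procedure and its fibres

Fibre : ∀ r k → (Fin (r * k) → Fin (r * k)) → List (Vec (Fin (r * k)) (r * k) × Vec (Fin (r * k)) (r * k))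
Fibre r k g = filter (λ st → produces? r k (proj₁ st) (proj₂ st) g)
                     (cartesianProduct (allPerms (r * k)) (allPerms (r * k)))

allWords! : ∀ n m → Unique (allWords n m)
allWords! n zero = All.[] AllPairs.∷ AllPairs.[]
allWords! n (suc m) =
  Unique.concat⁺ (All.map⁺ (All.tabulate⁺ (λ x → Unique.map⁺ Vec.∷-injectiveʳ (allWords! n m))))
    (AllPairs.map⁺ (AllPairs.map distinct-heads (Unique.allFin⁺ n)))
  where
  distinct-heads : ∀ {x y} → x ≢ y → ∀ {w} → ¬ (w ∈ map (x ∷_) (allWords n m) × w ∈ map (y ∷_) (allWords n m))
  distinct-heads x≢y (w∈ , w∈′) with _ , _ , refl ← ∈-map⁻ _ w∈ | _ , _ , e ← ∈-map⁻ _ w∈′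
    = x≢y (Vec.∷-injectiveˡ e)

∈-allWords : ∀ n m (v : Vec (Fin n) m) → v ∈ allWords n m
∈-allWords n zero    []      = here refl
∈-allWords n (suc m) (x ∷ v) = ∈-concat⁺′ (∈-map⁺ (x ∷_) (∈-allWords n m v)) (∈-map⁺ _ (∈-allFin x))

Fibre! : ∀ r k g → Unique (Fibre r k g)
Fibre! r k g = Unique.filter⁺ _ (Unique.cartesianProduct⁺ perms! perms!)
  where
  perms! : Unique (allPerms (r * k))
  perms! = Unique.filter⁺ isPerm? (allWords! (r * k) (r * k))

∈-Fibre⁺ : ∀ r k g {σ τ} → IsPerm σ → IsPerm τ → Produces r k σ τ g → (σ , τ) ∈ Fibre r k g
∈-Fibre⁺ r k g σ-perm τ-perm prod =
  ∈-filter⁺ (λ st → produces? r k (proj₁ st) (proj₂ st) g)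
    (∈-cartesianProduct⁺ (∈-filter⁺ isPerm? (∈-allWords _ _ _) σ-perm) (∈-filter⁺ isPerm? (∈-allWords _ _ _) τ-perm))
    prod

∈-Fibre⁻ : ∀ r k g {σ τ} → (σ , τ) ∈ Fibre r k g → IsPerm σ × IsPerm τ × Produces r k σ τ g
∈-Fibre⁻ r k g st∈
  with st∈S² , prod ← ∈-filter⁻ (λ st → produces? r k (proj₁ st) (proj₂ st) g)
                                 {xs = cartesianProduct (allPerms (r * k)) (allPerms (r * k))} st∈
  with σ∈ , τ∈ ← ∈-cartesianProduct⁻ (allPerms (r * k)) (allPerms (r * k)) st∈S²
  = isPerm σ∈ , isPerm τ∈ , prod
  where
  isPerm : ∀ {v} → v ∈ allPerms (r * k) → IsPerm v
  isPerm v∈ = proj₂ (∈-filter⁻ isPerm? {xs = allWords (r * k) (r * k)} v∈)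

produces-relabel : ∀ r k {f g} (R : Relabelling f g) {σ τ} → Produces r k σ τ f →
  Produces r k (Vec.map (to (cod R)) σ) (Vec.map (to (dom R)) τ) g
produces-relabel r k {f} {g} R {σ} {τ} prod p = begin
  g (Vec.lookup (Vec.map (to (dom R)) τ) p)     ≡⟨ cong g (Vec.lookup-map p (to (dom R)) τ) ⟩
  g (to (dom R) (Vec.lookup τ p))              ≡⟨ commutes R _ ⟩
  to (cod R) (f (Vec.lookup τ p))              ≡⟨ cong (to (cod R)) (prod p) ⟩
  to (cod R) (Vec.lookup σ (blockPos r k p))   ≡⟨ Vec.lookup-map (blockPos r k p) (to (cod R)) σ ⟨
  Vec.lookup (Vec.map (to (cod R)) σ) (blockPos r k p) ∎

-- Relabelling is a bijection between fibres, so fibre sizes agree.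
fibreSize-relabel : ∀ r k {f g} → Relabelling f g → fibreSize r k f ≡ fibreSize r k g
fibreSize-relabel r k {f} {g} R =
  length-≡-by-bijection act (Fibre! r k f) (Fibre! r k g) act-injective into onto
  where
  Run : Set
  Run = Vec (Fin (r * k)) (r * k) × Vec (Fin (r * k)) (r * k)
  act : Run → Run
  act (σ , τ) = Vec.map (to (cod R)) σ , Vec.map (to (dom R)) τ
  act-injective : Injective _≡_ _≡_ act
  act-injective e = cong₂ _,_ (map-to-injective (cod R) (cong proj₁ e))
                              (map-to-injective (dom R) (cong proj₂ e))
  into : ∀ {st} → st ∈ Fibre r k f → act st ∈ Fibre r k g
  into {σ , τ} st∈ with σ-perm , τ-perm , prod ← ∈-Fibre⁻ r k f st∈
    = ∈-Fibre⁺ r k g (map-isPerm (cod R) σ-perm) (map-isPerm (dom R) τ-perm) (produces-relabel r k R {σ} {τ} prod)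
  onto : ∀ {st} → st ∈ Fibre r k g → ∃ λ st′ → st′ ∈ Fibre r k f × st ≡ act st′
  onto {σ , τ} st∈ with σ-perm , τ-perm , prod ← ∈-Fibre⁻ r k g st∈ =
    (Vec.map (from (cod R)) σ , Vec.map (from (dom R)) τ) ,
    ∈-Fibre⁺ r k f (map-isPerm (cod R⁻¹) σ-perm) (map-isPerm (dom R⁻¹) τ-perm) (produces-relabel r k R⁻¹ {σ} {τ} prod) ,
    sym (cong₂ _,_ (map-from-to (cod R) σ) (map-from-to (dom R) τ))
    where
    R⁻¹ : Relabelling g f
    R⁻¹ = relabel-sym R

theorem6p1 : (r k : ℕ) → 1 ≤ r → 2 ≤ k →
    ((σ τ : Vec (Fin (r * k)) (r * k)) → IsPerm σ → IsPerm τ →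
      Σ (Fin (r * k) → Fin (r * k)) (λ f → Produces r k σ τ f × Is0kMapping k f))
    × ((f g : Fin (r * k) → Fin (r * k)) → Is0kMapping k f → Is0kMapping k g →
      fibreSize r k f ≡ fibreSize r k g)
theorem6p1 r k _ 2≤k = output-is0k , fibres-equal
  where
  instance
    k-nonZero : NonZero k
    k-nonZero = ℕ.>-nonZero (ℕ.<-trans ℕ.z<s 2≤k)

  -- The run (σ, τ) outputs f = σ ∘ c ∘ τ⁻¹, a relabelling of c.
  output-is0k : (σ τ : Vec (Fin (r * k)) (r * k)) → IsPerm σ → IsPerm τ →
    Σ (Fin (r * k) → Fin (r * k)) (λ f → Produces r k σ τ f × Is0kMapping k f)
  output-is0k σ τ σ-perm τ-perm = output , commutes run , relabel-is0k run (blockPos-is0k r k)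
    where
    σ↔ τ↔ : Fin (r * k) ↔ Fin (r * k)
    σ↔ = word↔ σ σ-perm
    τ↔ = word↔ τ τ-perm
    output : Fin (r * k) → Fin (r * k)
    output = to σ↔ ∘ blockPos r k ∘ from τ↔
    run : Relabelling (blockPos r k) output
    run = record { cod = σ↔ ; dom = τ↔ ; commutes = λ p → cong (to σ↔ ∘ blockPos r k) (strictlyInverseʳ τ↔ p) }

  -- Two {0,k}-mappings are relabellings of each other, hence have equal fibres.
  fibres-equal : (f g : Fin (r * k) → Fin (r * k)) → Is0kMapping k f → Is0kMapping k g →
    fibreSize r k f ≡ fibreSize r k g
  fibres-equal f g f-0k g-0k = fibreSize-relabel r k
    (relabel-trans (relabel-sym (CanonicalForm.relabelling r k f f-0k)) (CanonicalForm.relabelling r k g g-0k))
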